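{- $q_n^{\mathcal{A}^{\mathrm{q\text{ - }select}},\mathrm{non}}<2n$: for every input multiset of size $n$ and every non-adaptive adversarial comparator, the expected number of queries of quick-select is less than $2n$.
   Context: Model: there are $n$ items with real values (a multiset $\mathcal{X}$). A faulty comparator takes two distinct inputs; if their values differ by more than $1$ it returns the larger, otherwise it returns either one, possibly adversarially. A non-adaptive adversarial comparator knows $\mathcal{X}$ and the algorithm but fixes its output for every pair before the algorithm starts. Each comparison is a query; $Q_n^{\mathcal{A}}$ is the number of queries, $q_n^{\mathcal{A}}=\mathbb{E}[Q_n^{\mathcal{A}}]$ over the algorithm's randomness, and $q_n^{\mathcal{A},\mathrm{non}}=\max_{\mathcal{C}}\max_{\mathcal{X}}q_n^{\mathcal{A}}$ over non-adaptive adversarial comparators. Subroutine $\mathcal{A}^{\mathrm{qs\text{ - }sub}}$ (input multiset $\mathcal{X}$): pick a pivot $x_p\in\mathcal{X}$ uniformly at random, compare $x_p$ with all other inputs, let $\mathcal{Y}\subset\mathcal{X}\setminus\{x_p\}$ be those that beat $x_p$; output $\mathcal{Y}$ if nonempty and $\{x_p\}$ otherwise. Quick-select $\mathcal{A}^{\mathrm{q\text{ - }select}}$: while $|\mathcal{X}|>1$ set $\mathcal{X}\leftarrow\mathcal{A}^{\mathrm{qs\text{ - }sub}}(\mathcal{X})$; output the unique remaining input.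
   Formalization: The values of the items in the multiset $\mathcal{X}$ are rational rather than real. -}

module Defs where

open import Data.Nat as ℕ using (ℕ; zero; suc)
open import Data.Integer using (+_)
open import Data.Fin using (Fin)
open import Data.Fin.Properties using (_≟_)
open import Data.List using (List; []; _∷_; length; map; filter; concatMap; allFin)
open import Data.Product using (_×_; _,_)
open import Data.Sum using (_⊎_)
open import Data.Rational using (ℚ; _+_; _*_; _-_; _<_; _/_; 0ℚ; 1ℚ)
open import Relation.Binary.PropositionalEquality using (_≡_; _≢_)

-- For each pair of distinct inputs {i , j} the output
-- (the winner) is fixed in advance; it is one of i , j; and if the values
-- differ by more than 1 it is the one with larger value.
record NonAdaptiveComparator (n : ℕ) (x : Fin n → ℚ) : Set where
  field
    winner    : Fin n → Fin n → Fin n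
    winner-sym : ∀ i j → winner i j ≡ winner j i
    winner-arg : ∀ i j → i ≢ j → winner i j ≡ i ⊎ winner i j ≡ j
    winner-ok  : ∀ i j → i ≢ j → 1ℚ < x i - x j → winner i j ≡ i

Dist : Set → Set
Dist A = List (ℚ × A)

picks : {A : Set} → List A → List (A × List A)
picks [] = []
picks (a ∷ as) = (a , as) ∷ map (λ { (b , bs) → (b , a ∷ bs) }) (picks as)

module QuickSelect {n : ℕ} {x : Fin n → ℚ} (C : NonAdaptiveComparator n x) where
  open NonAdaptiveComparator C

  beaters : Fin n → List (Fin n) → List (Fin n)
  beaters p rest = filter (λ y → winner y p ≟ y) rest

  subOut : Fin n → List (Fin n) → List (Fin n)
  subOut p rest with beaters p rest
  ... | [] = p ∷ []
  ... | Y@(_ ∷ _) = Y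

  qsSub : List (Fin n) → Dist (ℕ × List (Fin n))
  qsSub [] = []
  qsSub X@(_ ∷ xs) =
    map (λ { (p , rest) → (+ 1 / length X , (length xs , subOut p rest)) }) (picks X)

  -- A^{q-select} run with fuel (fuel = |X| always suffices, since every round
  -- strictly shrinks the set); distribution of (total queries , output)
  qselect : ℕ → List (Fin n) → Dist (ℕ × Fin n)
  qselect _ [] = []
  qselect _ (a ∷ []) = (1ℚ , (0 , a)) ∷ []
  qselect zero (_ ∷ _ ∷ _) = []
  qselect (suc f) X@(_ ∷ _ ∷ _) =
    concatMap (λ { (w , (q , Y)) →
                 map (λ { (w' , (q' , o)) → (w * w' , (q ℕ.+ q' , o)) }) (qselect f Y) })
              (qsSub X)

  expectedQueries : ℚ
  expectedQueries = go (qselect n (allFin n))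
    where
    go : Dist (ℕ × Fin n) → ℚ
    go [] = 0ℚ
    go ((w , (q , _)) ∷ d) = w * (+ q / 1) + go d

-- A round on m distinct inputs makes m − 1 queries and, for pivot p, leaves at most
-- 1 + (number of inputs beating p) inputs.  Restricted to distinct inputs the comparator is
-- a tournament (every pair has exactly one winner), so the numbers of beaters summed over all
-- pivots give m(m − 1)/2.  By induction on m, if at most 2(m′ − 1) queries are expected on m′
-- inputs, the expected cost on m inputs is at most (m − 1) + 2 · (m − 1)/2 = 2(m − 1) < 2m.
-- The values x and the hypothesis winner-ok play no role.

module Submission where

open import Defs
open import Data.Nat using (ℕ; NonZero; _*_)
open import Data.Integer using (+_)
open import Data.Fin using (Fin)
open import Data.Rational using (ℚ; _<_; _/_)

open import Data.Empty using (⊥-elim)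
import Data.Fin.Properties as FinP
import Data.Integer as ℤ
import Data.Integer.Properties as ℤP
open import Data.List using (List; []; _∷_; _++_; length; map; filter; concatMap; allFin)
import Data.List.Properties as ListP
open import Data.List.Relation.Binary.Permutation.Propositional
  using (_↭_; ↭-refl; ↭-prep; ↭-swap; ↭-trans; ↭-sym; ↭⇒↭ₛ)
import Data.List.Relation.Binary.Permutation.Setoid.Properties as Permutationₛ
open import Data.List.Relation.Unary.All as All using (All; []; _∷_)
import Data.List.Relation.Unary.All.Properties as AllP
open import Data.List.Relation.Unary.AllPairs using ([]; _∷_)
open import Data.List.Relation.Unary.Unique.Propositional using (Unique)
import Data.List.Relation.Unary.Unique.Propositional.Properties as UniqueP
open import Data.Nat as ℕ using (zero; suc; _∸_)
import Data.Nat.Coprimality as Coprimality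
open import Data.Nat.ListAction using (sum)
import Data.Nat.Properties as ℕP
open import Algebra.Properties.CommutativeSemigroup ℕP.+-commutativeSemigroup using (x∙yz≈y∙xz)
open import Data.Nat.Solver using (module +-*-Solver)
open import Data.Product using (_×_; _,_; proj₁; proj₂; uncurry)
open import Data.Rational as Q using (mkℚ; 0ℚ; 1ℚ; _≤_)
import Data.Rational.Properties as QP
import Data.Rational.Solver as QSolver
open import Data.Sum using (_⊎_; inj₁; inj₂; [_,_]′)
open import Relation.Binary.Definitions using (Decidable)
open import Relation.Binary.PropositionalEquality
  using (_≡_; _≢_; refl; sym; trans; cong; cong₂; setoid; module ≡-Reasoning)
open import Relation.Nullary using (yes; no)

fromℕ : ℕ → ℚ
fromℕ k = + k / 1

fromℕ≡mkℚ : ∀ k → fromℕ k ≡ mkℚ (+ k) 0 (Coprimality.sym (Coprimality.1-coprimeTo k))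
fromℕ≡mkℚ k = QP.normalize-coprime _

fromℕ-homo-+ : ∀ a b → fromℕ (a ℕ.+ b) ≡ fromℕ a Q.+ fromℕ b
fromℕ-homo-+ a b =
  trans (cong (_/ 1) (sym (cong₂ ℤ._+_ (ℤP.*-identityʳ (+ a)) (ℤP.*-identityʳ (+ b)))))
        (sym (cong₂ Q._+_ (fromℕ≡mkℚ a) (fromℕ≡mkℚ b)))

fromℕ-homo-* : ∀ a b → fromℕ (a * b) ≡ fromℕ a Q.* fromℕ b
fromℕ-homo-* a b =
  trans (cong (_/ 1) (ℤP.pos-* a b)) (sym (cong₂ Q._*_ (fromℕ≡mkℚ a) (fromℕ≡mkℚ b)))

fromℕ-nonNeg : ∀ k → 0ℚ ≤ fromℕ k
fromℕ-nonNeg k = QP.nonNegative⁻¹ _ {{QP.normalize-nonNeg k 1}}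

fromℕ-mono-≤ : ∀ {a b} → a ℕ.≤ b → fromℕ a ≤ fromℕ b
fromℕ-mono-≤ {a} {b} a≤b = begin
  fromℕ a                    ≡⟨ sym (QP.+-identityʳ (fromℕ a)) ⟩
  fromℕ a Q.+ 0ℚ             ≤⟨ QP.+-monoʳ-≤ (fromℕ a) (fromℕ-nonNeg (b ∸ a)) ⟩
  fromℕ a Q.+ fromℕ (b ∸ a)  ≡⟨ sym (fromℕ-homo-+ a (b ∸ a)) ⟩
  fromℕ (a ℕ.+ (b ∸ a))      ≡⟨ cong fromℕ (ℕP.m+[n∸m]≡n a≤b) ⟩
  fromℕ b                    ∎
  where open QP.≤-Reasoning

fromℕ-mono-< : ∀ {a b} → a ℕ.< b → fromℕ a < fromℕ b
fromℕ-mono-< {a} {b} a<b = begin-strict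
  fromℕ a            ≡⟨ sym (QP.+-identityˡ (fromℕ a)) ⟩
  0ℚ Q.+ fromℕ a     <⟨ QP.+-monoˡ-< (fromℕ a) (QP.positive⁻¹ 1ℚ) ⟩
  1ℚ Q.+ fromℕ a     ≡⟨ sym (fromℕ-homo-+ 1 a) ⟩
  fromℕ (suc a)      ≤⟨ fromℕ-mono-≤ a<b ⟩
  fromℕ b            ∎
  where open QP.≤-Reasoning

1/n-nonNeg : ∀ n .{{_ : NonZero n}} → 0ℚ ≤ + 1 / n
1/n-nonNeg n = QP.nonNegative⁻¹ _ {{QP.normalize-nonNeg 1 n}}

1/n*n≡1 : ∀ k → (+ 1 / suc k) Q.* fromℕ (suc k) ≡ 1ℚ
1/n*n≡1 k =
  trans (cong₂ Q._*_ (QP.normalize-coprime (Coprimality.1-coprimeTo (suc k))) (fromℕ≡mkℚ (suc k)))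
        (QP.*-inverseˡ (mkℚ (+ suc k) 0 (Coprimality.sym (Coprimality.1-coprimeTo (suc k)))))

1/n*fromℕ[n*m]≡fromℕ[m] : ∀ k m → (+ 1 / suc k) Q.* fromℕ (suc k * m) ≡ fromℕ m
1/n*fromℕ[n*m]≡fromℕ[m] k m = begin
  c Q.* fromℕ (suc k * m)               ≡⟨ cong (c Q.*_) (fromℕ-homo-* (suc k) m) ⟩
  c Q.* (fromℕ (suc k) Q.* fromℕ m)     ≡⟨ sym (QP.*-assoc c (fromℕ (suc k)) (fromℕ m)) ⟩
  (c Q.* fromℕ (suc k)) Q.* fromℕ m     ≡⟨ cong (Q._* fromℕ m) (1/n*n≡1 k) ⟩
  1ℚ Q.* fromℕ m                        ≡⟨ QP.*-identityˡ (fromℕ m) ⟩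
  fromℕ m                               ∎
  where
  open ≡-Reasoning
  c = + 1 / suc k

sum-map-mono-≤ : {B : Set} {f g : B → ℕ} → (∀ b → f b ℕ.≤ g b) →
  ∀ L → sum (map f L) ℕ.≤ sum (map g L)
sum-map-mono-≤ f≤g [] = ℕ.z≤n
sum-map-mono-≤ f≤g (b ∷ L) = ℕP.+-mono-≤ (f≤g b) (sum-map-mono-≤ f≤g L)

sum-map-affine : {B : Set} (k c : ℕ) (f : B → ℕ) (L : List B) →
  sum (map (λ b → k ℕ.+ c * f b) L) ≡ length L * k ℕ.+ c * sum (map f L)
sum-map-affine k c f [] = sym (ℕP.*-zeroʳ c)
sum-map-affine k c f (b ∷ L) =
  trans (cong (k ℕ.+ c * f b ℕ.+_) (sum-map-affine k c f L))
        (solve 5 (λ k c y l s → k :+ c :* y :+ (l :* k :+ c :* s) := (con 1 :+ l) :* k :+ c :* (y :+ s))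
               refl k c (f b) (length L) (sum (map f L)))
  where open +-*-Solver

mass : {A : Set} → Dist A → ℚ
mass [] = 0ℚ
mass ((w , _) ∷ d) = w Q.+ mass d

mass-++ : {A : Set} (d e : Dist A) → mass (d ++ e) ≡ mass d Q.+ mass e
mass-++ [] e = sym (QP.+-identityˡ (mass e))
mass-++ ((w , _) ∷ d) e = trans (cong (w Q.+_) (mass-++ d e)) (sym (QP.+-assoc w (mass d) (mass e)))

module _ {A : Set} where

  expectation : Dist (ℕ × A) → ℚ
  expectation [] = 0ℚ
  expectation ((w , (q , _)) ∷ d) = w Q.* fromℕ q Q.+ expectation d

  expectation-unique : {g : Dist (ℕ × A) → ℚ} → g [] ≡ 0ℚ →
    (∀ w q a d → g ((w , (q , a)) ∷ d) ≡ w Q.* fromℕ q Q.+ g d) → ∀ d → g d ≡ expectation d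
  expectation-unique g[] g∷ [] = g[]
  expectation-unique g[] g∷ ((w , (q , a)) ∷ d) =
    trans (g∷ w q a d) (cong (w Q.* fromℕ q Q.+_) (expectation-unique g[] g∷ d))

  -- mass ≤ 1 rather than = 1 spares proving that the fuel of qselect suffices.
  record CostBounded (B : ℕ) (d : Dist (ℕ × A)) : Set where
    field
      mass≤1       : mass d ≤ 1ℚ
      expectation≤ : expectation d ≤ fromℕ B

  []-costBounded : ∀ B → CostBounded B []
  []-costBounded B = record { mass≤1 = QP.nonNegative⁻¹ 1ℚ ; expectation≤ = fromℕ-nonNeg B }

  expectation-++ : ∀ d e → expectation (d ++ e) ≡ expectation d Q.+ expectation e
  expectation-++ [] e = sym (QP.+-identityˡ (expectation e))
  expectation-++ ((w , (q , _)) ∷ d) e =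
    trans (cong (w Q.* fromℕ q Q.+_) (expectation-++ d e))
          (sym (QP.+-assoc (w Q.* fromℕ q) (expectation d) (expectation e)))

  afterStep : ℚ → ℕ → ℚ × (ℕ × A) → ℚ × (ℕ × A)
  afterStep w q (w′ , (q′ , a)) = (w Q.* w′ , (q ℕ.+ q′ , a))

  mass-afterStep : ∀ w q d → mass (map (afterStep w q) d) ≡ w Q.* mass d
  mass-afterStep w q [] = sym (QP.*-zeroʳ w)
  mass-afterStep w q ((w′ , _) ∷ d) =
    trans (cong (w Q.* w′ Q.+_) (mass-afterStep w q d)) (sym (QP.*-distribˡ-+ w w′ (mass d)))

  expectation-afterStep : ∀ w q d →
    expectation (map (afterStep w q) d) ≡ w Q.* (fromℕ q Q.* mass d Q.+ expectation d)
  expectation-afterStep w q [] =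
    solve 2 (λ w q → con 0ℚ := w :* (q :* con 0ℚ :+ con 0ℚ)) refl w (fromℕ q)
    where open QSolver.+-*-Solver
  expectation-afterStep w q ((w′ , (q′ , _)) ∷ d) =
    trans (cong₂ (λ u v → w Q.* w′ Q.* u Q.+ v) (fromℕ-homo-+ q q′) (expectation-afterStep w q d))
          (solve 6 (λ w w′ q q′ m e → w :* w′ :* (q :+ q′) :+ w :* (q :* m :+ e)
                                      := w :* (q :* (w′ :+ m) :+ (w′ :* q′ :+ e)))
                 refl w w′ (fromℕ q) (fromℕ q′) (mass d) (expectation d))
    where open QSolver.+-*-Solver

  mass-map-const : ∀ {B : Set} c (f : B → ℕ × A) L →
    mass (map (λ b → (c , f b)) L) ≡ c Q.* fromℕ (length L)
  mass-map-const c f [] = sym (QP.*-zeroʳ c)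
  mass-map-const c f (b ∷ L) = begin
    c Q.+ mass (map (λ b → (c , f b)) L)  ≡⟨ cong (c Q.+_) (mass-map-const c f L) ⟩
    c Q.+ c Q.* fromℕ (length L)          ≡⟨ cong (Q._+ c Q.* fromℕ (length L)) (sym (QP.*-identityʳ c)) ⟩
    c Q.* 1ℚ Q.+ c Q.* fromℕ (length L)   ≡⟨ sym (QP.*-distribˡ-+ c 1ℚ (fromℕ (length L))) ⟩
    c Q.* (1ℚ Q.+ fromℕ (length L))       ≡⟨ cong (c Q.*_) (sym (fromℕ-homo-+ 1 (length L))) ⟩
    c Q.* fromℕ (suc (length L))          ∎
    where open ≡-Reasoning

  expectation-map-const : ∀ {B : Set} c (cost : B → ℕ) (out : B → A) L →
    expectation (map (λ b → (c , (cost b , out b))) L) ≡ c Q.* fromℕ (sum (map cost L))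
  expectation-map-const c cost out [] = sym (QP.*-zeroʳ c)
  expectation-map-const c cost out (b ∷ L) = begin
    c Q.* fromℕ (cost b) Q.+ expectation (map (λ b → (c , (cost b , out b))) L)
      ≡⟨ cong (c Q.* fromℕ (cost b) Q.+_) (expectation-map-const c cost out L) ⟩
    c Q.* fromℕ (cost b) Q.+ c Q.* fromℕ (sum (map cost L))
      ≡⟨ sym (QP.*-distribˡ-+ c (fromℕ (cost b)) (fromℕ (sum (map cost L)))) ⟩
    c Q.* (fromℕ (cost b) Q.+ fromℕ (sum (map cost L)))
      ≡⟨ cong (c Q.*_) (sym (fromℕ-homo-+ (cost b) (sum (map cost L)))) ⟩
    c Q.* fromℕ (cost b ℕ.+ sum (map cost L))
      ∎
    where open ≡-Reasoning

bind : {A B : Set} → Dist (ℕ × B) → (B → Dist (ℕ × A)) → Dist (ℕ × A)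
bind d k = concatMap (λ { (w , (q , b)) → map (afterStep w q) (k b) }) d

addCost : {B : Set} → (B → ℕ) → ℚ × (ℕ × B) → ℚ × (ℕ × B)
addCost g (w , (q , b)) = (w , (q ℕ.+ g b , b))

module _ {A B : Set} (k : B → Dist (ℕ × A)) (g : B → ℕ) where

  ContinuationBounded : ℚ × (ℕ × B) → Set
  ContinuationBounded (w , (_ , b)) = 0ℚ ≤ w × CostBounded (g b) (k b)

  mass-bind-≤ : ∀ d → All ContinuationBounded d → mass (bind d k) ≤ mass d
  mass-bind-≤ [] [] = QP.≤-refl
  mass-bind-≤ ((w , (q , b)) ∷ d) ((0≤w , bounded) ∷ bounded-d) = begin
    mass (map (afterStep w q) (k b) ++ bind d k)
      ≡⟨ mass-++ (map (afterStep w q) (k b)) (bind d k) ⟩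
    mass (map (afterStep w q) (k b)) Q.+ mass (bind d k)
      ≡⟨ cong (Q._+ mass (bind d k)) (mass-afterStep w q (k b)) ⟩
    w Q.* mass (k b) Q.+ mass (bind d k)
      ≤⟨ QP.+-mono-≤ w*mass≤w (mass-bind-≤ d bounded-d) ⟩
    w Q.+ mass d
      ∎
    where
    open QP.≤-Reasoning
    w*mass≤w : w Q.* mass (k b) ≤ w
    w*mass≤w = QP.≤-trans (QP.*-monoˡ-≤-nonNeg w {{Q.nonNegative 0≤w}} (CostBounded.mass≤1 bounded))
                          (QP.≤-reflexive (QP.*-identityʳ w))

  expectation-bind-≤ : ∀ d → All ContinuationBounded d →
    expectation (bind d k) ≤ expectation (map (addCost g) d)
  expectation-bind-≤ [] [] = QP.≤-refl
  expectation-bind-≤ ((w , (q , b)) ∷ d) ((0≤w , bounded) ∷ bounded-d) = begin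
    expectation (map (afterStep w q) (k b) ++ bind d k)
      ≡⟨ expectation-++ (map (afterStep w q) (k b)) (bind d k) ⟩
    expectation (map (afterStep w q) (k b)) Q.+ expectation (bind d k)
      ≡⟨ cong (Q._+ expectation (bind d k)) (expectation-afterStep w q (k b)) ⟩
    w Q.* (fromℕ q Q.* mass (k b) Q.+ expectation (k b)) Q.+ expectation (bind d k)
      ≤⟨ QP.+-mono-≤ (QP.*-monoˡ-≤-nonNeg w {{Q.nonNegative 0≤w}} step≤)
                     (expectation-bind-≤ d bounded-d) ⟩
    w Q.* (fromℕ q Q.* 1ℚ Q.+ fromℕ (g b)) Q.+ expectation (map (addCost g) d)
      ≡⟨ cong (λ z → w Q.* z Q.+ expectation (map (addCost g) d))
              (trans (cong (Q._+ fromℕ (g b)) (QP.*-identityʳ (fromℕ q))) (sym (fromℕ-homo-+ q (g b)))) ⟩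
    w Q.* fromℕ (q ℕ.+ g b) Q.+ expectation (map (addCost g) d)
      ∎
    where
    open QP.≤-Reasoning
    open CostBounded bounded
    step≤ : fromℕ q Q.* mass (k b) Q.+ expectation (k b) ≤ fromℕ q Q.* 1ℚ Q.+ fromℕ (g b)
    step≤ = QP.+-mono-≤ (QP.*-monoˡ-≤-nonNeg (fromℕ q) {{Q.nonNegative (fromℕ-nonNeg q)}} mass≤1)
                        expectation≤

module _ {A : Set} where

  length-picks : (X : List A) → length (picks X) ≡ length X
  length-picks [] = refl
  length-picks (a ∷ as) = cong suc (trans (ListP.length-map _ (picks as)) (length-picks as))

  map-proj₁-picks : (X : List A) → map proj₁ (picks X) ≡ X
  map-proj₁-picks [] = refl
  map-proj₁-picks (a ∷ as) = cong (a ∷_) (trans (sym (ListP.map-∘ (picks as))) (map-proj₁-picks as))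

  picks-↭ : (X : List A) → All (uncurry λ p rest → p ∷ rest ↭ X) (picks X)
  picks-↭ [] = []
  picks-↭ (a ∷ as) = ↭-refl ∷ AllP.map⁺ (All.map
    (λ p∷rest↭as → ↭-trans (↭-swap _ a ↭-refl) (↭-prep a p∷rest↭as))
    (picks-↭ as))

  picks-unique : (X : List A) → Unique X → All (uncurry λ p rest → Unique (p ∷ rest)) (picks X)
  picks-unique X unique-X = All.map
    (λ p∷rest↭X → Permutationₛ.Unique-resp-↭ (setoid A) (↭⇒↭ₛ (↭-sym p∷rest↭X)) unique-X)
    (picks-↭ X)

module Tournament {A : Set} {R : A → A → Set} (R? : Decidable R)
  (connex : ∀ {x y} → x ≢ y → R x y ⊎ R y x)
  (antisym : ∀ {x y} → R x y → R y x → x ≡ y) where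

  inDegree : A × List A → ℕ
  inDegree (p , rest) = length (filter (λ y → R? y p) rest)

  outDegree : A × List A → ℕ
  outDegree (p , rest) = length (filter (R? p) rest)

  inDegree+outDegree : ∀ p rest → All (p ≢_) rest →
    inDegree (p , rest) ℕ.+ outDegree (p , rest) ≡ length rest
  inDegree+outDegree p [] [] = refl
  inDegree+outDegree p (y ∷ ys) (p≢y ∷ p∉ys) with R? y p | R? p y
  ... | yes yRp | yes pRy = ⊥-elim (p≢y (antisym pRy yRp))
  ... | yes _   | no _    = cong suc (inDegree+outDegree p ys p∉ys)
  ... | no _    | yes _   = trans (ℕP.+-suc _ _) (cong suc (inDegree+outDegree p ys p∉ys))
  ... | no ¬yRp | no ¬pRy = ⊥-elim ([ ¬pRy , ¬yRp ]′ (connex p≢y))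

  sum-inDegree-insert : ∀ a (L : List (A × List A)) →
    sum (map inDegree (map (λ { (b , bs) → (b , a ∷ bs) }) L))
      ≡ length (filter (R? a) (map proj₁ L)) ℕ.+ sum (map inDegree L)
  sum-inDegree-insert a [] = refl
  sum-inDegree-insert a ((b , bs) ∷ L) with R? a b
  ... | yes _ = cong suc (trans (cong (inDegree (b , bs) ℕ.+_) (sum-inDegree-insert a L))
                                (x∙yz≈y∙xz (inDegree (b , bs)) (length (filter (R? a) (map proj₁ L))) _))
  ... | no _  = trans (cong (inDegree (b , bs) ℕ.+_) (sum-inDegree-insert a L))
                      (x∙yz≈y∙xz (inDegree (b , bs)) (length (filter (R? a) (map proj₁ L))) _)

  sum-inDegree-picks-∷ : ∀ a as → All (a ≢_) as →
    sum (map inDegree (picks (a ∷ as))) ≡ length as ℕ.+ sum (map inDegree (picks as))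
  sum-inDegree-picks-∷ a as a∉as = begin
    inDegree (a , as) ℕ.+ sum (map inDegree (map _ (picks as)))
      ≡⟨ cong (inDegree (a , as) ℕ.+_) (sum-inDegree-insert a (picks as)) ⟩
    inDegree (a , as) ℕ.+ (length (filter (R? a) (map proj₁ (picks as))) ℕ.+ S)
      ≡⟨ cong (λ ys → inDegree (a , as) ℕ.+ (length (filter (R? a) ys) ℕ.+ S)) (map-proj₁-picks as) ⟩
    inDegree (a , as) ℕ.+ (outDegree (a , as) ℕ.+ S)
      ≡⟨ sym (ℕP.+-assoc (inDegree (a , as)) (outDegree (a , as)) S) ⟩
    inDegree (a , as) ℕ.+ outDegree (a , as) ℕ.+ S
      ≡⟨ cong (ℕ._+ S) (inDegree+outDegree a as a∉as) ⟩
    length as ℕ.+ S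
      ∎
    where
    open ≡-Reasoning
    S = sum (map inDegree (picks as))

  sum-inDegree-picks : ∀ a as → Unique (a ∷ as) →
    2 * sum (map inDegree (picks (a ∷ as))) ≡ suc (length as) * length as
  sum-inDegree-picks a [] _ = refl
  sum-inDegree-picks a (b ∷ bs) (a∉b∷bs ∷ unique-b∷bs) = begin
    2 * sum (map inDegree (picks (a ∷ b ∷ bs)))
      ≡⟨ cong (2 *_) (sum-inDegree-picks-∷ a (b ∷ bs) a∉b∷bs) ⟩
    2 * (suc l ℕ.+ sum (map inDegree (picks (b ∷ bs))))
      ≡⟨ ℕP.*-distribˡ-+ 2 (suc l) _ ⟩
    2 * suc l ℕ.+ 2 * sum (map inDegree (picks (b ∷ bs)))
      ≡⟨ cong (2 * suc l ℕ.+_) (sum-inDegree-picks b bs unique-b∷bs) ⟩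
    2 * suc l ℕ.+ suc l * l
      ≡⟨ solve 1 (λ l → con 2 :* (con 1 :+ l) :+ (con 1 :+ l) :* l := (con 2 :+ l) :* (con 1 :+ l)) refl l ⟩
    suc (suc l) * suc l
      ∎
    where
    open ≡-Reasoning
    open +-*-Solver
    l = length bs

module _ {n : ℕ} {x : Fin n → ℚ} (C : NonAdaptiveComparator n x) where
  open NonAdaptiveComparator C
  open QuickSelect C

  beats? : Decidable (λ y p → winner y p ≡ y)
  beats? y p = winner y p FinP.≟ y

  beats-connex : ∀ {y p} → y ≢ p → winner y p ≡ y ⊎ winner p y ≡ p
  beats-connex {y} {p} y≢p with winner-arg y p y≢p
  ... | inj₁ y-wins = inj₁ y-wins
  ... | inj₂ p-wins = inj₂ (trans (winner-sym p y) p-wins)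

  beats-antisym : ∀ {y p} → winner y p ≡ y → winner p y ≡ p → y ≡ p
  beats-antisym {y} {p} y-wins p-wins = trans (sym y-wins) (trans (winner-sym y p) p-wins)

  open Tournament beats? beats-connex beats-antisym

  length-subOut∸1≤inDegree : ∀ p rest → length (subOut p rest) ∸ 1 ℕ.≤ inDegree (p , rest)
  length-subOut∸1≤inDegree p rest with beaters p rest
  ... | []        = ℕ.z≤n
  ... | Y@(_ ∷ _) = ℕP.m∸n≤m (length Y) 1

  subOut-unique : ∀ p rest → Unique (p ∷ rest) → Unique (subOut p rest)
  subOut-unique p rest (_ ∷ unique-rest)
    with beaters p rest | UniqueP.filter⁺ (λ y → beats? y p) unique-rest
  ... | []    | _              = [] ∷ []
  ... | _ ∷ _ | unique-beaters = unique-beaters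

  costBound : List (Fin n) → ℕ
  costBound Y = 2 * (length Y ∸ 1)

  roundCost : ℕ → Fin n × List (Fin n) → ℕ
  roundCost k (p , rest) = k ℕ.+ costBound (subOut p rest)

  sum-roundCost-≤ : ∀ a as → Unique (a ∷ as) →
    sum (map (roundCost (length as)) (picks (a ∷ as))) ℕ.≤ suc (length as) * (2 * length as)
  sum-roundCost-≤ a as unique = begin
    sum (map (roundCost k) (picks X))
      ≤⟨ sum-map-mono-≤ roundCost≤ (picks X) ⟩
    sum (map (λ pr → k ℕ.+ 2 * inDegree pr) (picks X))
      ≡⟨ sum-map-affine k 2 inDegree (picks X) ⟩
    length (picks X) * k ℕ.+ 2 * sum (map inDegree (picks X))
      ≡⟨ cong₂ (λ l s → l * k ℕ.+ s) (length-picks X) (sum-inDegree-picks a as unique) ⟩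
    suc k * k ℕ.+ suc k * k
      ≡⟨ solve 1 (λ k → (con 1 :+ k) :* k :+ (con 1 :+ k) :* k := (con 1 :+ k) :* (con 2 :* k)) refl k ⟩
    suc k * (2 * k)
      ∎
    where
    open ℕP.≤-Reasoning
    open +-*-Solver
    k = length as
    X = a ∷ as
    roundCost≤ : ∀ pr → roundCost k pr ℕ.≤ k ℕ.+ 2 * inDegree pr
    roundCost≤ (p , rest) = ℕP.+-monoʳ-≤ k (ℕP.*-monoʳ-≤ 2 (length-subOut∸1≤inDegree p rest))

  qsSub-continuationBounded : (k : List (Fin n) → Dist (ℕ × Fin n)) →
    (∀ Y → Unique Y → CostBounded (costBound Y) (k Y)) →
    ∀ X → Unique X → All (ContinuationBounded k costBound) (qsSub X)
  qsSub-continuationBounded k bounded [] _ = []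
  qsSub-continuationBounded k bounded X@(_ ∷ _) unique = AllP.map⁺ (All.map
    (λ {pr} unique-pick →
       1/n-nonNeg (length X) , bounded _ (subOut-unique (proj₁ pr) (proj₂ pr) unique-pick))
    (picks-unique X unique))

  mass-qsSub : ∀ a as → mass (qsSub (a ∷ as)) ≡ 1ℚ
  mass-qsSub a as = begin
    mass (qsSub X)                ≡⟨ mass-map-const c _ (picks X) ⟩
    c Q.* fromℕ (length (picks X)) ≡⟨ cong (λ l → c Q.* fromℕ l) (length-picks X) ⟩
    c Q.* fromℕ (suc (length as))  ≡⟨ 1/n*n≡1 (length as) ⟩
    1ℚ                            ∎
    where
    open ≡-Reasoning
    X = a ∷ as
    c = + 1 / suc (length as)

  expectation-round-≤ : ∀ a as → Unique (a ∷ as) →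
    expectation (map (addCost costBound) (qsSub (a ∷ as))) ≤ fromℕ (2 * length as)
  expectation-round-≤ a as unique = begin
    expectation (map (addCost costBound) (qsSub X))
      ≡⟨ cong expectation (sym (ListP.map-∘ {g = addCost costBound} {f = entry} (picks X))) ⟩
    expectation (map (λ pr → (c , (roundCost k pr , uncurry subOut pr))) (picks X))
      ≡⟨ expectation-map-const c (roundCost k) (uncurry subOut) (picks X) ⟩
    c Q.* fromℕ (sum (map (roundCost k) (picks X)))
      ≤⟨ QP.*-monoˡ-≤-nonNeg c {{Q.nonNegative (1/n-nonNeg (suc k))}}
                             (fromℕ-mono-≤ (sum-roundCost-≤ a as unique)) ⟩
    c Q.* fromℕ (suc k * (2 * k))
      ≡⟨ 1/n*fromℕ[n*m]≡fromℕ[m] k (2 * k) ⟩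
    fromℕ (2 * k)
      ∎
    where
    open QP.≤-Reasoning
    k = length as
    X = a ∷ as
    c = + 1 / suc k
    entry : Fin n × List (Fin n) → ℚ × (ℕ × List (Fin n))
    entry pr = (c , (k , uncurry subOut pr))

  qselect-costBounded : ∀ fuel Y → Unique Y → CostBounded (costBound Y) (qselect fuel Y)
  qselect-costBounded _ [] _ = []-costBounded 0
  qselect-costBounded _ (_ ∷ []) _ = record { mass≤1 = QP.≤-refl ; expectation≤ = QP.≤-refl }
  qselect-costBounded zero (_ ∷ _ ∷ _) _ = []-costBounded _
  qselect-costBounded (suc fuel) X@(a ∷ as@(_ ∷ _)) unique = record
    { mass≤1       = QP.≤-trans (mass-bind-≤ k costBound (qsSub X) bounded-qsSub)
                                (QP.≤-reflexive (mass-qsSub a as))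
    ; expectation≤ = QP.≤-trans (expectation-bind-≤ k costBound (qsSub X) bounded-qsSub)
                                (expectation-round-≤ a as unique)
    }
    where
    k = qselect fuel
    bounded-qsSub = qsSub-continuationBounded k (qselect-costBounded fuel) X unique

  -- expectedQueries sums with a local function of Defs that cannot be named; once the
  -- distribution is abstracted, unification recovers it as sumQueries.
  expectedQueries≡expectation : expectedQueries ≡ expectation (qselect n (allFin n))
  expectedQueries≡expectation = proof
    where
    sumQueries : Dist (ℕ × Fin n) → ℚ
    sumQueries = _
    proof : expectedQueries ≡ expectation (qselect n (allFin n))
    proof with qselect n (allFin n)
    ... | d = expectation-unique {g = sumQueries} refl (λ _ _ _ _ → refl) d

lemma6 : (n : ℕ) → .{{_ : NonZero n}} → (x : Fin n → ℚ) →
    (C : NonAdaptiveComparator n x) →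
    QuickSelect.expectedQueries C < + (2 * n) / 1
lemma6 n@(suc k) x C = begin-strict
  QuickSelect.expectedQueries C
    ≡⟨ expectedQueries≡expectation C ⟩
  expectation (QuickSelect.qselect C n (allFin n))
    ≤⟨ CostBounded.expectation≤ (qselect-costBounded C n (allFin n) (UniqueP.allFin⁺ n)) ⟩
  fromℕ (costBound C (allFin n))
    ≡⟨ cong (λ l → fromℕ (2 * (l ∸ 1))) (ListP.length-tabulate {n = n} (λ i → i)) ⟩
  fromℕ (2 * k)
    <⟨ fromℕ-mono-< (ℕP.*-monoʳ-< 2 (ℕP.n<1+n k)) ⟩
  fromℕ (2 * n)
    ∎
  where open QP.≤-Reasoning
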